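{- For any graph $G$, $nevc(G)=mvc(G)$ if and only if for every vertex $v$ of degree one in $G$ there exists a minimum vertex cover $S_v$ of $G$ with $v\in S_v$.
   Context: $mvc(G)$ is the size of a minimum vertex cover of $G$. New eternal vertex cover game on $G$: a defender first places guards on vertices, at most one per vertex. In each round an attacker attacks an edge; in response each guard may move along a walk of at most two edges without retracing (it may not return along the edge it just used), and at least one guard on an endpoint of the attacked edge must traverse the attacked edge as its first step. Several guards may pass through a vertex during the move, but afterwards there is at most one guard per vertex. If no valid response exists the attacker wins; the defender wins if she can respond to every attack of an infinite sequence. $nevc(G)$ is the minimum number of guards for which the defender has a winning strategy. -}

module Defs where

open import Data.Nat using (ℕ; _≤_; _<_)
open import Data.Bool using (Bool; true; false)
open import Data.Fin using (Fin)
open import Data.Fin.Subset using (Subset; _∈_; ∣_∣)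
open import Data.Vec using (tabulate)
open import Data.Product using (Σ; ∃; _×_; _,_)
open import Data.Sum using (_⊎_)
open import Data.Empty using (⊥)
open import Relation.Nullary using (¬_)
open import Relation.Binary.PropositionalEquality using (_≡_)
open import Function.Definitions using (Injective)

record Graph (n : ℕ) : Set where
  field
    adj   : Fin n → Fin n → Bool
    sym   : ∀ u v → adj u v ≡ adj v u
    irrefl : ∀ v → adj v v ≡ false

module _ {n : ℕ} (G : Graph n) where
  open Graph G

  Edge : Fin n → Fin n → Set
  Edge u v = adj u v ≡ true

  degree : Fin n → ℕ
  degree v = ∣ tabulate (adj v) ∣

  IsVertexCover : Subset n → Set
  IsVertexCover S = ∀ u v → Edge u v → u ∈ S ⊎ v ∈ S

  IsMinVertexCover : Subset n → Set
  IsMinVertexCover S = IsVertexCover S × (∀ T → IsVertexCover T → ∣ S ∣ ≤ ∣ T ∣)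

  MvcIs : ℕ → Set
  MvcIs k = Σ (Subset n) (λ S → IsMinVertexCover S × ∣ S ∣ ≡ k)

  -- A walk of at most two edges from v to w which does not retrace
  -- (a two-edge walk may not return to its start along the edge just used).
  data Walk : Fin n → Fin n → Set where
    stay  : ∀ v → Walk v v
    step1 : ∀ {v u} → Edge v u → Walk v u
    step2 : ∀ {v u w} → Edge v u → Edge u w → ¬ (w ≡ v) → Walk v w

  FirstStepTo : ∀ {v w} → Walk v w → Fin n → Set
  FirstStepTo (stay _) x = ⊥
  FirstStepTo (step1 {u = u} _) x = u ≡ x
  FirstStepTo (step2 {u = u} _ _ _) x = u ≡ x

  -- A configuration of k guards: guard i stands on vertex c i
  -- (at most one guard per vertex is the injectivity of c).
  Config : ℕ → Set
  Config k = Fin k → Fin n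

  Response : ∀ {k} → Fin n → Fin n → Config k → Config k → Set
  Response {k} a b c c' =
    Σ ((i : Fin k) → Walk (c i) (c' i)) λ w →
      Injective _≡_ _≡_ c' ×
      (∃ λ i → (c i ≡ a × FirstStepTo (w i) b) ⊎ (c i ≡ b × FirstStepTo (w i) a))

  -- A winning strategy for the defender, given as the set W of configurations
  -- she may be in between rounds: from every configuration in W, every attack
  -- admits a valid response leading back into W.  (Any history-dependent
  -- strategy yields such a W, namely its set of reachable configurations.)
  Closed : ∀ {k} → (Config k → Set) → Set
  Closed {k} W = ∀ c → W c → ∀ a b → Edge a b →
                   Σ (Config k) λ c' → Response a b c c' × W c'

  DefenderWins : ℕ → Set₁
  DefenderWins k = Σ (Config k → Set) λ W → Closed W ×
                     Σ (Config k) λ c → Injective _≡_ _≡_ c × W c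

  NevcIs : ℕ → Set₁
  NevcIs k = DefenderWins k × (∀ j → j < k → ¬ DefenderWins j)

-- With k = mvc(G) guards, every position of a winning strategy is a minimum vertex cover, since
-- each attacked edge needs a guard at one of its endpoints. Attacking the edge at a leaf v forces
-- a guard onto v (a guard stepping onto v cannot continue without retracing), so v lies in some
-- minimum cover. Conversely, the defender keeps her guards on a minimum vertex cover S. An attack
-- on an edge inside S, or on ab with a ∈ S, b ∉ S where b has a second neighbour w (necessarily
-- in S), is answered by exchanging two guards along a→b(→w) and back. If b is a leaf, take a
-- minimum cover T ∋ b: minimality of S yields Hall's condition from S ∖ T to T ∖ S, and
-- |T ∖ S| ≤ |S ∖ T|, so a matching maps S ∖ T onto T ∖ S. Moving every guard of S ∖ T along it
-- turns S into T, and the guard matched to b comes from b's only neighbour a.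

module Submission where

open import Defs
open import Data.Nat using (ℕ; zero; suc; _+_; _≤_; _<_; z≤n; s≤s; _≤?_)
open import Data.Nat.Properties
  using (≤-refl; ≤-trans; ≤-reflexive; ≤-pred; <-irrefl; ≤-<-trans; <-≤-trans; +-suc; n≤1+n;
         +-cancelˡ-≤; +-cancelʳ-≤; +-monoʳ-≤; ≰⇒>; <⇒≱; module ≤-Reasoning)
open import Data.Bool using (Bool; true; false)
import Data.Bool as Bool
open import Data.Fin using (Fin; zero; suc)
open import Data.Fin.Properties using (_≟_; any?; suc-injective; ¬Fin0)
open import Data.Fin.Subset
open import Data.Fin.Subset.Properties
open import Data.Vec using ([]; _∷_; tabulate; here; there)
open import Data.Vec.Properties using ([]=⇒lookup; lookup⇒[]=; lookup∘tabulate)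
open import Data.Product using (Σ; ∃; _×_; _,_; proj₁)
open import Data.Sum using (_⊎_; inj₁; inj₂)
import Data.Sum as Sum
open import Data.Empty using (⊥-elim)
open import Relation.Unary using (Decidable)
open import Relation.Nullary using (¬_; Dec; yes; no; does; ¬?)
open import Relation.Nullary.Decidable using (_×-dec_; dec-true)
open import Relation.Binary.PropositionalEquality
open import Function.Definitions using (Injective)
open import Function.Bundles using (_⇔_; mk⇔)
open import Function.Base using (_∘′_)
open import Data.Fin.Permutation.Components using (transpose; transpose-inverse)

private variable
  n : ℕ
  x y : Fin n
  p q r : Subset n

∈-tabulate⁺ : ∀ {f : Fin n → Bool} → f x ≡ true → x ∈ tabulate f
∈-tabulate⁺ {x = x} {f} fx = lookup⇒[]= x (tabulate f) (trans (lookup∘tabulate f x) fx)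

∈-tabulate⁻ : ∀ {f : Fin n → Bool} → x ∈ tabulate f → f x ≡ true
∈-tabulate⁻ {x = x} {f} x∈ = trans (sym (lookup∘tabulate f x)) ([]=⇒lookup x∈)

fromPred : {P : Fin n → Set} → Decidable P → Subset n
fromPred P? = tabulate (λ x → does (P? x))

module _ {P : Fin n → Set} (P? : Decidable P) where

  ∈-fromPred⁺ : P x → x ∈ fromPred P?
  ∈-fromPred⁺ {x} Px = ∈-tabulate⁺ (dec-true (P? x) Px)

  ∈-fromPred⁻ : x ∈ fromPred P? → P x
  ∈-fromPred⁻ {x} x∈ with P? x | ∈-tabulate⁻ {f = λ x → does (P? x)} x∈
  ... | yes Px | _ = Px

Disjoint : Subset n → Subset n → Set
Disjoint p q = ∀ {x} → x ∈ p → x ∉ q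

Disjoint-∷⁻ : ∀ {s t} → Disjoint (s ∷ p) (t ∷ q) → Disjoint p q
Disjoint-∷⁻ p#q x∈p x∈q = p#q (there x∈p) (there x∈q)

x∈p─q⇒x∉q : ∀ (p q : Subset n) → Disjoint (p ─ q) q
x∈p─q⇒x∉q (_ ∷ p) (inside ∷ q) () here
x∈p─q⇒x∉q (_ ∷ p) (_ ∷ q) (there x∈) (there x∈q) = x∈p─q⇒x∉q p q x∈ x∈q

∣p∪q∣≤∣p∣+∣q∣ : ∀ (p q : Subset n) → ∣ p ∪ q ∣ ≤ ∣ p ∣ + ∣ q ∣
∣p∪q∣≤∣p∣+∣q∣ []            []            = z≤n
∣p∪q∣≤∣p∣+∣q∣ (outside ∷ p) (outside ∷ q) = ∣p∪q∣≤∣p∣+∣q∣ p q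
∣p∪q∣≤∣p∣+∣q∣ (outside ∷ p) (inside ∷ q)  = ≤-trans (s≤s (∣p∪q∣≤∣p∣+∣q∣ p q)) (≤-reflexive (sym (+-suc ∣ p ∣ ∣ q ∣)))
∣p∪q∣≤∣p∣+∣q∣ (inside ∷ p)  (outside ∷ q) = s≤s (∣p∪q∣≤∣p∣+∣q∣ p q)
∣p∪q∣≤∣p∣+∣q∣ (inside ∷ p)  (inside ∷ q)  = s≤s (≤-trans (∣p∪q∣≤∣p∣+∣q∣ p q) (≤-trans (n≤1+n _) (≤-reflexive (sym (+-suc ∣ p ∣ ∣ q ∣)))))

∣p∣+∣q∣≤∣p∪q∣ : ∀ (p q : Subset n) → Disjoint p q → ∣ p ∣ + ∣ q ∣ ≤ ∣ p ∪ q ∣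
∣p∣+∣q∣≤∣p∪q∣ []            []            _   = z≤n
∣p∣+∣q∣≤∣p∪q∣ (outside ∷ p) (outside ∷ q) p#q = ∣p∣+∣q∣≤∣p∪q∣ p q (Disjoint-∷⁻ p#q)
∣p∣+∣q∣≤∣p∪q∣ (outside ∷ p) (inside ∷ q)  p#q = ≤-trans (≤-reflexive (+-suc ∣ p ∣ ∣ q ∣)) (s≤s (∣p∣+∣q∣≤∣p∪q∣ p q (Disjoint-∷⁻ p#q)))
∣p∣+∣q∣≤∣p∪q∣ (inside ∷ p)  (outside ∷ q) p#q = s≤s (∣p∣+∣q∣≤∣p∪q∣ p q (Disjoint-∷⁻ p#q))
∣p∣+∣q∣≤∣p∪q∣ (inside ∷ p)  (inside ∷ q)  p#q = ⊥-elim (p#q here here)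

p⊆q∪r⇒∣p∣≤∣q∣+∣r∣ : ∀ (q r : Subset n) → p ⊆ q ∪ r → ∣ p ∣ ≤ ∣ q ∣ + ∣ r ∣
p⊆q∪r⇒∣p∣≤∣q∣+∣r∣ q r p⊆ = ≤-trans (p⊆q⇒∣p∣≤∣q∣ p⊆) (∣p∪q∣≤∣p∣+∣q∣ q r)

p∪q⊆r⇒∣p∣+∣q∣≤∣r∣ : ∀ (p q : Subset n) → Disjoint p q → p ∪ q ⊆ r → ∣ p ∣ + ∣ q ∣ ≤ ∣ r ∣
p∪q⊆r⇒∣p∣+∣q∣≤∣r∣ p q p#q ⊆r = ≤-trans (∣p∣+∣q∣≤∣p∪q∣ p q p#q) (p⊆q⇒∣p∣≤∣q∣ ⊆r)

∣p∣≤1+∣p-x∣ : ∀ (p : Subset n) x → ∣ p ∣ ≤ suc ∣ p - x ∣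
∣p∣≤1+∣p-x∣ p x = ≤-trans (p⊆q∪r⇒∣p∣≤∣q∣+∣r∣ ⁅ x ⁆ (p - x) p⊆) (≤-reflexive (cong (_+ ∣ p - x ∣) (∣⁅x⁆∣≡1 x)))
  where
  p⊆ : p ⊆ ⁅ x ⁆ ∪ (p - x)
  p⊆ {y} y∈p with y ≟ x
  ... | yes refl = x∈p∪q⁺ (inj₁ (x∈⁅x⁆ x))
  ... | no y≢x   = x∈p∪q⁺ (inj₂ (x∈p∧x≢y⇒x∈p-y y∈p y≢x))

Empty⇒∣p∣≡0 : Empty p → ∣ p ∣ ≡ 0
Empty⇒∣p∣≡0 {n} p=∅ rewrite Empty-unique p=∅ = ∣⊥∣≡0 n

0<∣p∣⇒Nonempty : 0 < ∣ p ∣ → Nonempty p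
0<∣p∣⇒Nonempty {p = p} 0<∣p∣ with nonempty? p
... | yes p≠∅ = p≠∅
... | no  p=∅ = ⊥-elim (<-irrefl (sym (Empty⇒∣p∣≡0 p=∅)) 0<∣p∣)

Nonempty⇒0<∣p∣ : Nonempty p → 0 < ∣ p ∣
Nonempty⇒0<∣p∣ (x , x∈p) = ≤-<-trans z≤n (x∈p⇒∣p-x∣<∣p∣ x∈p)

x∈p⇒⁅x⁆⊆p : x ∈ p → ⁅ x ⁆ ⊆ p
x∈p⇒⁅x⁆⊆p {x = x} {p} x∈p y∈⁅x⁆ = subst (_∈ p) (sym (x∈⁅y⁆⇒x≡y x y∈⁅x⁆)) x∈p

∣q─p∣≤∣p─q∣ : ∀ (p q : Subset n) → ∣ q ∣ ≤ ∣ p ∣ → ∣ q ─ p ∣ ≤ ∣ p ─ q ∣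
∣q─p∣≤∣p─q∣ p q ∣q∣≤∣p∣ = +-cancelʳ-≤ ∣ p ∩ q ∣ _ _ (begin
    ∣ q ─ p ∣ + ∣ p ∩ q ∣   ≤⟨ p∪q⊆r⇒∣p∣+∣q∣≤∣r∣ (q ─ p) (p ∩ q) (λ x∈ → x∈p─q⇒x∉q q p x∈ ∘′ proj₁ ∘′ x∈p∩q⁻ p q) ⊆q ⟩
    ∣ q ∣                   ≤⟨ ∣q∣≤∣p∣ ⟩
    ∣ p ∣                   ≤⟨ p⊆q∪r⇒∣p∣≤∣q∣+∣r∣ (p ─ q) (p ∩ q) p⊆ ⟩
    ∣ p ─ q ∣ + ∣ p ∩ q ∣   ∎)
  where
  open ≤-Reasoning
  ⊆q : (q ─ p) ∪ (p ∩ q) ⊆ q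
  ⊆q x∈ with x∈p∪q⁻ (q ─ p) (p ∩ q) x∈
  ... | inj₁ x∈q─p = p─q⊆p q p x∈q─p
  ... | inj₂ x∈p∩q = p∩q⊆q p q x∈p∩q
  p⊆ : p ⊆ (p ─ q) ∪ (p ∩ q)
  p⊆ {x} x∈p with x ∈? q
  ... | yes x∈q = x∈p∪q⁺ (inj₂ (x∈p∩q⁺ (x∈p , x∈q)))
  ... | no  x∉q = x∈p∪q⁺ (inj₁ (x∈p∧x∉q⇒x∈p─q x∈p x∉q))

MapsTo : (Fin n → Fin n) → Subset n → Subset n → Set
MapsTo f p q = ∀ {x} → x ∈ p → f x ∈ q

InjectiveOn : (Fin n → Fin n) → Subset n → Set
InjectiveOn f p = ∀ {x y} → x ∈ p → y ∈ p → f x ≡ f y → x ≡ y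

injectiveOn⇒∣p∣≤∣q∣ : ∀ (f : Fin n → Fin n) → MapsTo f p q → InjectiveOn f p → ∣ p ∣ ≤ ∣ q ∣
injectiveOn⇒∣p∣≤∣q∣ {p = p} {q} f = go ∣ p ∣ p q ≤-refl
  where
  go : ∀ m p q → ∣ p ∣ ≤ m → MapsTo f p q → InjectiveOn f p → ∣ p ∣ ≤ ∣ q ∣
  go m p q _ _ _ with nonempty? p
  ... | no p=∅ = ≤-trans (≤-reflexive (Empty⇒∣p∣≡0 p=∅)) z≤n
  go zero p q ∣p∣≤0 _ _ | yes p≠∅ = ⊥-elim (<-irrefl refl (<-≤-trans (Nonempty⇒0<∣p∣ p≠∅) ∣p∣≤0))
  go (suc m) p q ∣p∣≤1+m into inj | yes (x , x∈p) = begin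
      ∣ p ∣              ≤⟨ ∣p∣≤1+∣p-x∣ p x ⟩
      suc ∣ p - x ∣      ≤⟨ s≤s (go m (p - x) (q - f x) ∣p-x∣≤m into′ inj′) ⟩
      suc ∣ q - f x ∣    ≤⟨ x∈p⇒∣p-x∣<∣p∣ (into x∈p) ⟩
      ∣ q ∣              ∎
    where
    open ≤-Reasoning
    ∣p-x∣≤m : ∣ p - x ∣ ≤ m
    ∣p-x∣≤m = ≤-pred (<-≤-trans (x∈p⇒∣p-x∣<∣p∣ x∈p) ∣p∣≤1+m)
    inj′ : InjectiveOn f (p - x)
    inj′ y∈ z∈ = inj (p─q⊆p p ⁅ x ⁆ y∈) (p─q⊆p p ⁅ x ⁆ z∈)
    into′ : MapsTo f (p - x) (q - f x)
    into′ y∈ = x∈p∧x≢y⇒x∈p-y (into (p─q⊆p p ⁅ x ⁆ y∈))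
      (x∉⁅y⁆⇒x≢y (x∈p─q⇒x∉q p ⁅ x ⁆ y∈) ∘′ inj (p─q⊆p p ⁅ x ⁆ y∈) x∈p)

injectiveOn⇒surjectiveOn : ∀ (f : Fin n → Fin n) → MapsTo f p q → InjectiveOn f p → ∣ q ∣ ≤ ∣ p ∣ →
                           ∀ {y} → y ∈ q → ∃ λ x → x ∈ p × f x ≡ y
injectiveOn⇒surjectiveOn {p = p} {q} f into inj ∣q∣≤∣p∣ {y} y∈q
  with any? (λ x → (x ∈? p) ×-dec (f x ≟ y))
... | yes hit = hit
... | no miss = ⊥-elim (<-irrefl refl (≤-<-trans ∣p∣≤∣q-y∣ (<-≤-trans (x∈p⇒∣p-x∣<∣p∣ y∈q) ∣q∣≤∣p∣)))
  where
  ∣p∣≤∣q-y∣ : ∣ p ∣ ≤ ∣ q - y ∣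
  ∣p∣≤∣q-y∣ = injectiveOn⇒∣p∣≤∣q∣ f (λ {x} x∈p → x∈p∧x≢y⇒x∈p-y (into x∈p) (λ fx≡y → miss (x , x∈p , fx≡y))) inj

module Hall {_~_ : Fin n → Fin n → Set} (_~?_ : ∀ x y → Dec (x ~ y)) where

  N : Subset n → Subset n
  N Z = fromPred (λ y → any? (λ x → (x ∈? Z) ×-dec (x ~? y)))

  ∈-N⁺ : ∀ {Z} → x ∈ Z → x ~ y → y ∈ N Z
  ∈-N⁺ {x = x} {Z = Z} x∈Z x~y = ∈-fromPred⁺ (λ y → any? (λ x → (x ∈? Z) ×-dec (x ~? y))) (x , x∈Z , x~y)

  ∈-N⁻ : ∀ {Z} → y ∈ N Z → ∃ λ x → x ∈ Z × x ~ y
  ∈-N⁻ {Z = Z} = ∈-fromPred⁻ (λ y → any? (λ x → (x ∈? Z) ×-dec (x ~? y)))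

  HallCondition : Subset n → Subset n → Set
  HallCondition X Y = ∀ Z → Z ⊆ X → ∣ Z ∣ ≤ ∣ N Z ∩ Y ∣

  record Matching (X Y : Subset n) : Set where
    field
      f           : Fin n → Fin n
      mapsTo      : MapsTo f X Y
      injectiveOn : InjectiveOn f X
      matched     : ∀ {x} → x ∈ X → x ~ f x

  open Matching

  empty-matching : ∀ {X Y} → Empty X → Matching X Y
  empty-matching X=∅ = record
    { f = λ x → x ; mapsTo = λ x∈X → ⊥-elim (X=∅ (_ , x∈X))
    ; injectiveOn = λ x∈X _ _ → ⊥-elim (X=∅ (_ , x∈X)) ; matched = λ x∈X → ⊥-elim (X=∅ (_ , x∈X)) }

  singleton-matching : x ~ y → Matching ⁅ x ⁆ ⁅ y ⁆
  singleton-matching {x = x} {y} x~y = record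
    { f = λ _ → y ; mapsTo = λ _ → x∈⁅x⁆ y
    ; injectiveOn = λ {u} {v} u∈ v∈ _ → trans (x∈⁅y⁆⇒x≡y x u∈) (sym (x∈⁅y⁆⇒x≡y x v∈))
    ; matched = λ u∈ → subst (_~ y) (sym (x∈⁅y⁆⇒x≡y x u∈)) x~y }

  module _ {X Y Z Y₁ Y₂ : Subset n} (Z⊆X : Z ⊆ X) (Y₁⊆Y : Y₁ ⊆ Y) (Y₂⊆Y : Y₂ ⊆ Y) (Y₂#Y₁ : Disjoint Y₂ Y₁)
           (M₁ : Matching Z Y₁) (M₂ : Matching (X ─ Z) Y₂) where

    private
      g : Fin n → Fin n
      g x with x ∈? Z
      ... | yes _ = f M₁ x
      ... | no  _ = f M₂ x

      g-mapsTo : MapsTo g X Y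
      g-mapsTo {x} x∈X with x ∈? Z
      ... | yes x∈Z = Y₁⊆Y (mapsTo M₁ x∈Z)
      ... | no  x∉Z = Y₂⊆Y (mapsTo M₂ (x∈p∧x∉q⇒x∈p─q x∈X x∉Z))

      g-matched : ∀ {x} → x ∈ X → x ~ g x
      g-matched {x} x∈X with x ∈? Z
      ... | yes x∈Z = matched M₁ x∈Z
      ... | no  x∉Z = matched M₂ (x∈p∧x∉q⇒x∈p─q x∈X x∉Z)

      g-injectiveOn : InjectiveOn g X
      g-injectiveOn {x} {x′} x∈X x′∈X gx≡gx′ with x ∈? Z | x′ ∈? Z
      ... | yes x∈Z | yes x′∈Z = injectiveOn M₁ x∈Z x′∈Z gx≡gx′
      ... | no  x∉Z | no  x′∉Z = injectiveOn M₂ (x∈p∧x∉q⇒x∈p─q x∈X x∉Z) (x∈p∧x∉q⇒x∈p─q x′∈X x′∉Z) gx≡gx′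
      ... | yes x∈Z | no  x′∉Z =
        ⊥-elim (Y₂#Y₁ (mapsTo M₂ (x∈p∧x∉q⇒x∈p─q x′∈X x′∉Z)) (subst (_∈ Y₁) gx≡gx′ (mapsTo M₁ x∈Z)))
      ... | no  x∉Z | yes x′∈Z =
        ⊥-elim (Y₂#Y₁ (mapsTo M₂ (x∈p∧x∉q⇒x∈p─q x∈X x∉Z)) (subst (_∈ Y₁) (sym gx≡gx′) (mapsTo M₁ x′∈Z)))

    glue : Matching X Y
    glue = record { f = g ; mapsTo = g-mapsTo ; injectiveOn = g-injectiveOn ; matched = g-matched }

  hall-restrict : ∀ {X Y Z} → HallCondition X Y → Z ⊆ X → HallCondition Z (N Z ∩ Y)
  hall-restrict {Y = Y} {Z} hc Z⊆X Z′ Z′⊆Z = ≤-trans (hc Z′ (Z⊆X ∘′ Z′⊆Z)) (p⊆q⇒∣p∣≤∣q∣ N⊆)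
    where
    N⊆ : N Z′ ∩ Y ⊆ N Z′ ∩ (N Z ∩ Y)
    N⊆ y∈ with x∈p∩q⁻ (N Z′) Y y∈
    ... | y∈NZ′ , y∈Y with ∈-N⁻ y∈NZ′
    ...   | x , x∈Z′ , x~y = x∈p∩q⁺ (y∈NZ′ , x∈p∩q⁺ (∈-N⁺ (Z′⊆Z x∈Z′) x~y , y∈Y))

  hall-contract : ∀ {X Y Z} → HallCondition X Y → Z ⊆ X → ∣ N Z ∩ Y ∣ ≤ ∣ Z ∣ → HallCondition (X ─ Z) (Y ─ N Z)
  hall-contract {X} {Y} {Z} hc Z⊆X tight Z′ Z′⊆X─Z = +-cancelʳ-≤ ∣ Z ∣ _ _ (begin
      ∣ Z′ ∣ + ∣ Z ∣                            ≤⟨ p∪q⊆r⇒∣p∣+∣q∣≤∣r∣ Z′ Z (x∈p─q⇒x∉q X Z ∘′ Z′⊆X─Z) ⊆-refl ⟩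
      ∣ Z′ ∪ Z ∣                                ≤⟨ hc (Z′ ∪ Z) Z′∪Z⊆X ⟩
      ∣ N (Z′ ∪ Z) ∩ Y ∣                        ≤⟨ p⊆q∪r⇒∣p∣≤∣q∣+∣r∣ (N Z′ ∩ (Y ─ N Z)) (N Z ∩ Y) N⊆ ⟩
      ∣ N Z′ ∩ (Y ─ N Z) ∣ + ∣ N Z ∩ Y ∣        ≤⟨ +-monoʳ-≤ ∣ N Z′ ∩ (Y ─ N Z) ∣ tight ⟩
      ∣ N Z′ ∩ (Y ─ N Z) ∣ + ∣ Z ∣              ∎)
    where
    open ≤-Reasoning
    Z′∪Z⊆X : Z′ ∪ Z ⊆ X
    Z′∪Z⊆X x∈ with x∈p∪q⁻ Z′ Z x∈
    ... | inj₁ x∈Z′ = p─q⊆p X Z (Z′⊆X─Z x∈Z′)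
    ... | inj₂ x∈Z  = Z⊆X x∈Z
    N⊆ : N (Z′ ∪ Z) ∩ Y ⊆ (N Z′ ∩ (Y ─ N Z)) ∪ (N Z ∩ Y)
    N⊆ {y} y∈ with x∈p∩q⁻ (N (Z′ ∪ Z)) Y y∈
    ... | y∈N , y∈Y with y ∈? N Z
    ...   | yes y∈NZ = x∈p∪q⁺ (inj₂ (x∈p∩q⁺ (y∈NZ , y∈Y)))
    ...   | no  y∉NZ with ∈-N⁻ y∈N
    ...     | x , x∈Z′∪Z , x~y with x∈p∪q⁻ Z′ Z x∈Z′∪Z
    ...       | inj₁ x∈Z′ = x∈p∪q⁺ (inj₁ (x∈p∩q⁺ (∈-N⁺ x∈Z′ x~y , x∈p∧x∉q⇒x∈p─q y∈Y y∉NZ)))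
    ...       | inj₂ x∈Z  = ⊥-elim (y∉NZ (∈-N⁺ x∈Z x~y))

  Tight : Subset n → Subset n → Subset n → Set
  Tight X Y Z = Z ⊆ X × Nonempty Z × (∃ λ x → x ∈ X × x ∉ Z) × ∣ N Z ∩ Y ∣ ≤ ∣ Z ∣

  tight? : ∀ X Y Z → Dec (Tight X Y Z)
  tight? X Y Z = (Z ⊆? X) ×-dec nonempty? Z ×-dec any? (λ x → (x ∈? X) ×-dec ¬? (x ∈? Z)) ×-dec (∣ N Z ∩ Y ∣ ≤? ∣ Z ∣)

  hall-remove : ∀ {X Y} → (∀ Z → ¬ Tight X Y Z) → HallCondition X Y → x ∈ X → HallCondition (X - x) (Y - y)
  hall-remove {x = x} {y} {X} {Y} no-tight hc x∈X Z Z⊆X-x with nonempty? Z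
  ... | no Z=∅ = ≤-trans (≤-reflexive (Empty⇒∣p∣≡0 Z=∅)) z≤n
  ... | yes Z≠∅ with ∣ N Z ∩ Y ∣ ≤? ∣ Z ∣
  ...   | yes tight = ⊥-elim (no-tight Z (Z⊆X , Z≠∅ , (x , x∈X , x∉Z) , tight))
    where
    Z⊆X : Z ⊆ X
    Z⊆X = p─q⊆p X ⁅ x ⁆ ∘′ Z⊆X-x
    x∉Z : x ∉ Z
    x∉Z x∈Z = x∈p─q⇒x∉q X ⁅ x ⁆ (Z⊆X-x x∈Z) (x∈⁅x⁆ x)
  ...   | no loose = ≤-pred (begin-strict
      ∣ Z ∣                        <⟨ ≰⇒> loose ⟩
      ∣ N Z ∩ Y ∣                  ≤⟨ ∣p∣≤1+∣p-x∣ (N Z ∩ Y) y ⟩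
      suc ∣ (N Z ∩ Y) - y ∣        ≤⟨ s≤s (p⊆q⇒∣p∣≤∣q∣ ⊆N∩[Y-y]) ⟩
      suc ∣ N Z ∩ (Y - y) ∣        ∎)
    where
    open ≤-Reasoning
    ⊆N∩[Y-y] : (N Z ∩ Y) - y ⊆ N Z ∩ (Y - y)
    ⊆N∩[Y-y] z∈ with x∈p∩q⁻ (N Z) Y (p─q⊆p (N Z ∩ Y) ⁅ y ⁆ z∈)
    ... | z∈NZ , z∈Y = x∈p∩q⁺ (z∈NZ , x∈p∧x∉q⇒x∈p─q z∈Y (x∈p─q⇒x∉q (N Z ∩ Y) ⁅ y ⁆ z∈))

  hall-neighbour : ∀ {X Y} → HallCondition X Y → x ∈ X → ∃ λ y → y ∈ Y × x ~ y
  hall-neighbour {x = x} {X} {Y} hc x∈X with 0<∣p∣⇒Nonempty (≤-trans (≤-reflexive (sym (∣⁅x⁆∣≡1 x))) (hc ⁅ x ⁆ (x∈p⇒⁅x⁆⊆p x∈X)))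
  ... | y , y∈ with x∈p∩q⁻ (N ⁅ x ⁆) Y y∈
  ...   | y∈N , y∈Y with ∈-N⁻ y∈N
  ...     | x′ , x′∈⁅x⁆ , x′~y = y , y∈Y , subst (_~ y) (x∈⁅y⁆⇒x≡y x x′∈⁅x⁆) x′~y

  -- Induction on |X|: split along a tight set if there is one, otherwise match any x ∈ X to any neighbour.
  hall : ∀ {X Y} → HallCondition X Y → Matching X Y
  hall {X} {Y} = go ∣ X ∣ X Y ≤-refl
    where
    go : ∀ m X Y → ∣ X ∣ ≤ m → HallCondition X Y → Matching X Y
    go m X Y _ _ with nonempty? X
    ... | no X=∅ = empty-matching X=∅
    go zero X Y ∣X∣≤0 _ | yes X≠∅ = ⊥-elim (<-irrefl refl (<-≤-trans (Nonempty⇒0<∣p∣ X≠∅) ∣X∣≤0))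
    go (suc m) X Y ∣X∣≤1+m hc | yes (x , x∈X) with anySubset? (tight? X Y)
    ... | yes (Z , Z⊆X , (z , z∈Z) , (x′ , x′∈X , x′∉Z) , tight) =
      glue Z⊆X (p∩q⊆q (N Z) Y) (p─q⊆p Y (N Z)) (λ y∈ → x∈p─q⇒x∉q Y (N Z) y∈ ∘′ proj₁ ∘′ x∈p∩q⁻ (N Z) Y)
        (go m Z (N Z ∩ Y) ∣Z∣≤m (hall-restrict hc Z⊆X))
        (go m (X ─ Z) (Y ─ N Z) ∣X─Z∣≤m (hall-contract hc Z⊆X tight))
      where
      ∣Z∣≤m : ∣ Z ∣ ≤ m
      ∣Z∣≤m = ≤-pred (<-≤-trans (p⊂q⇒∣p∣<∣q∣ (Z⊆X , x′ , x′∈X , x′∉Z)) ∣X∣≤1+m)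
      ∣X─Z∣≤m : ∣ X ─ Z ∣ ≤ m
      ∣X─Z∣≤m = ≤-pred (<-≤-trans (p∩q≢∅⇒∣p─q∣<∣p∣ X Z (z , x∈p∩q⁺ (Z⊆X z∈Z , z∈Z))) ∣X∣≤1+m)
    ... | no no-tight with hall-neighbour hc x∈X
    ...   | y , y∈Y , x~y =
      glue (x∈p⇒⁅x⁆⊆p x∈X) (x∈p⇒⁅x⁆⊆p y∈Y) (p─q⊆p Y ⁅ y ⁆) (x∈p─q⇒x∉q Y ⁅ y ⁆)
        (singleton-matching x~y)
        (go m (X - x) (Y - y) ∣X-x∣≤m (hall-remove (λ Z t → no-tight (Z , t)) hc x∈X))
      where
      ∣X-x∣≤m : ∣ X - x ∣ ≤ m
      ∣X-x∣≤m = ≤-pred (<-≤-trans (x∈p⇒∣p-x∣<∣p∣ x∈X) ∣X∣≤1+m)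

image : ∀ {k} → (Fin k → Fin n) → Subset n
image c = fromPred (λ v → any? (λ i → c i ≟ v))

module _ {k} (c : Fin k → Fin n) where

  ∈-image⁺ : ∀ {i y} → c i ≡ y → y ∈ image c
  ∈-image⁺ {i} ci≡y = ∈-fromPred⁺ (λ v → any? (λ i → c i ≟ v)) (i , ci≡y)

  ∈-image⁻ : y ∈ image c → ∃ λ i → c i ≡ y
  ∈-image⁻ = ∈-fromPred⁻ (λ v → any? (λ i → c i ≟ v))

∣image∣≤k : ∀ k (c : Fin k → Fin n) → ∣ image c ∣ ≤ k
∣image∣≤k {n} zero c = ≤-trans (p⊆q⇒∣p∣≤∣q∣ {q = ⊥} (λ y∈ → ⊥-elim (¬Fin0 (proj₁ (∈-image⁻ c y∈))))) (≤-reflexive (∣⊥∣≡0 n))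
∣image∣≤k (suc k) c = begin
    ∣ image c ∣                          ≤⟨ p⊆q∪r⇒∣p∣≤∣q∣+∣r∣ ⁅ c zero ⁆ (image (c ∘′ suc)) image⊆ ⟩
    ∣ ⁅ c zero ⁆ ∣ + ∣ image (c ∘′ suc) ∣ ≡⟨ cong (_+ ∣ image (c ∘′ suc) ∣) (∣⁅x⁆∣≡1 (c zero)) ⟩
    suc ∣ image (c ∘′ suc) ∣             ≤⟨ s≤s (∣image∣≤k k (c ∘′ suc)) ⟩
    suc k                                ∎
  where
  open ≤-Reasoning
  image⊆ : image c ⊆ ⁅ c zero ⁆ ∪ image (c ∘′ suc)
  image⊆ y∈ with ∈-image⁻ c y∈
  ... | zero  , refl = x∈p∪q⁺ (inj₁ (x∈⁅x⁆ (c zero)))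
  ... | suc i , refl = x∈p∪q⁺ (inj₂ (∈-image⁺ (c ∘′ suc) refl))

enumerate : ∀ (S : Subset n) → Σ (Fin ∣ S ∣ → Fin n) λ c → Injective _≡_ _≡_ c × S ⊆ image c
enumerate []            = (λ ()) , (λ { {()} }) , (λ ())
enumerate (outside ∷ S) with enumerate S
... | c , c-inj , S⊆ = suc ∘′ c , c-inj ∘′ suc-injective , S′⊆
  where
  S′⊆ : outside ∷ S ⊆ image (suc ∘′ c)
  S′⊆ (there y∈S) with ∈-image⁻ c (S⊆ y∈S)
  ... | i , refl = ∈-image⁺ (suc ∘′ c) refl
enumerate (inside ∷ S) with enumerate S
... | c , c-inj , S⊆ = c′ , c′-inj , S′⊆
  where
  c′ : Fin (suc ∣ S ∣) → Fin _
  c′ zero    = zero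
  c′ (suc i) = suc (c i)
  c′-inj : Injective _≡_ _≡_ c′
  c′-inj {zero}  {zero}  _  = refl
  c′-inj {suc i} {suc j} eq = cong suc (c-inj (suc-injective eq))
  S′⊆ : inside ∷ S ⊆ image c′
  S′⊆ here = ∈-image⁺ c′ {zero} refl
  S′⊆ (there y∈S) with ∈-image⁻ c (S⊆ y∈S)
  ... | i , refl = ∈-image⁺ c′ {suc i} refl

transpose-preserves : ∀ (P : Fin n → Set) {i j k} → P i → P j → P k → P (transpose i j k)
transpose-preserves P {i} {j} {k} Pi Pj Pk with does (k ≟ i)
... | true  = Pj
... | false with does (k ≟ j)
...   | true  = Pi
...   | false = Pk

module _ (G : Graph n) where
  open Graph G using (adj)

  Edge? : ∀ x y → Dec (Edge G x y)
  Edge? x y = adj x y Bool.≟ true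

  open Hall Edge?

  Edge-sym : Edge G x y → Edge G y x
  Edge-sym {x} {y} xy = trans (Graph.sym G y x) xy

  leaf-neighbour : degree G x ≡ 1 → ∃ (Edge G x)
  leaf-neighbour deg≡1 with 0<∣p∣⇒Nonempty (≤-reflexive (sym deg≡1))
  ... | y , y∈ = y , ∈-tabulate⁻ y∈

  leaf-neighbour-unique : ∀ {u w} → degree G x ≡ 1 → Edge G x u → Edge G x w → u ≡ w
  leaf-neighbour-unique {x} {u} {w} deg≡1 xu xw with u ≟ w
  ... | yes u≡w = u≡w
  ... | no  u≢w = ⊥-elim (<-irrefl refl (begin
      2                       ≡⟨ sym (cong₂ _+_ (∣⁅x⁆∣≡1 u) (∣⁅x⁆∣≡1 w)) ⟩
      ∣ ⁅ u ⁆ ∣ + ∣ ⁅ w ⁆ ∣   ≤⟨ p∪q⊆r⇒∣p∣+∣q∣≤∣r∣ ⁅ u ⁆ ⁅ w ⁆ u#w ⁅u,w⁆⊆N ⟩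
      degree G x              ≡⟨ deg≡1 ⟩
      1                       ∎))
    where
    open ≤-Reasoning
    u#w : Disjoint ⁅ u ⁆ ⁅ w ⁆
    u#w y∈⁅u⁆ y∈⁅w⁆ = u≢w (trans (sym (x∈⁅y⁆⇒x≡y u y∈⁅u⁆)) (x∈⁅y⁆⇒x≡y w y∈⁅w⁆))
    ⁅u,w⁆⊆N : ⁅ u ⁆ ∪ ⁅ w ⁆ ⊆ tabulate (adj x)
    ⁅u,w⁆⊆N y∈ with x∈p∪q⁻ ⁅ u ⁆ ⁅ w ⁆ y∈
    ... | inj₁ y∈⁅u⁆ = x∈p⇒⁅x⁆⊆p (∈-tabulate⁺ xu) y∈⁅u⁆
    ... | inj₂ y∈⁅w⁆ = x∈p⇒⁅x⁆⊆p (∈-tabulate⁺ xw) y∈⁅w⁆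

  unique-neighbour⇒leaf : Edge G x y → (∀ {w} → Edge G x w → w ≡ y) → degree G x ≡ 1
  unique-neighbour⇒leaf {x} {y} xy only-y = trans (cong ∣_∣ N≡⁅y⁆) (∣⁅x⁆∣≡1 y)
    where
    N≡⁅y⁆ : tabulate (adj x) ≡ ⁅ y ⁆
    N≡⁅y⁆ = ⊆-antisym (λ w∈ → subst (_∈ ⁅ y ⁆) (sym (only-y (∈-tabulate⁻ w∈))) (x∈⁅x⁆ y))
                      (x∈p⇒⁅x⁆⊆p (∈-tabulate⁺ xy))

  walk-into-leaf : ∀ {v} (p : Walk G x y) → FirstStepTo G p v → (∀ {z} → Edge G v z → z ≡ x) → y ≡ v
  walk-into-leaf (step1 _)       first→v _      = first→v
  walk-into-leaf (step2 _ vy y≢x) refl    only-x = ⊥-elim (y≢x (only-x vy))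

  cover-mono : ∀ {S S′} → S ⊆ S′ → IsVertexCover G S → IsVertexCover G S′
  cover-mono S⊆S′ S-cover u v uv = Sum.map S⊆S′ S⊆S′ (S-cover u v uv)

  cover-transfer : ∀ {S S′} → (∀ {u v} → Edge G u v → u ∈ S → u ∈ S′ ⊎ v ∈ S′) →
                   IsVertexCover G S → IsVertexCover G S′
  cover-transfer covered S-cover u v uv with S-cover u v uv
  ... | inj₁ u∈S = covered uv u∈S
  ... | inj₂ v∈S = Sum.swap (covered (Edge-sym uv) v∈S)

  minCover-hallCondition : ∀ {S T} → IsVertexCover G S → (∀ U → IsVertexCover G U → ∣ S ∣ ≤ ∣ U ∣) →
                           IsVertexCover G T → HallCondition (S ─ T) (T ─ S)
  minCover-hallCondition {S} {T} S-cover S-min T-cover Z Z⊆S─T = +-cancelˡ-≤ ∣ S ─ Z ∣ _ _ (begin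
      ∣ S ─ Z ∣ + ∣ Z ∣               ≤⟨ p∪q⊆r⇒∣p∣+∣q∣≤∣r∣ (S ─ Z) Z (x∈p─q⇒x∉q S Z) S─Z∪Z⊆S ⟩
      ∣ S ∣                           ≤⟨ S-min S′ (cover-transfer covered S-cover) ⟩
      ∣ S′ ∣                          ≤⟨ ∣p∪q∣≤∣p∣+∣q∣ (S ─ Z) (N Z ∩ (T ─ S)) ⟩
      ∣ S ─ Z ∣ + ∣ N Z ∩ (T ─ S) ∣   ∎)
    where
    open ≤-Reasoning
    S′ : Subset n
    S′ = (S ─ Z) ∪ (N Z ∩ (T ─ S))
    S─Z∪Z⊆S : (S ─ Z) ∪ Z ⊆ S
    S─Z∪Z⊆S x∈ with x∈p∪q⁻ (S ─ Z) Z x∈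
    ... | inj₁ x∈S─Z = p─q⊆p S Z x∈S─Z
    ... | inj₂ x∈Z   = p─q⊆p S T (Z⊆S─T x∈Z)
    covered : ∀ {u v} → Edge G u v → u ∈ S → u ∈ S′ ⊎ v ∈ S′
    covered {u} {v} uv u∈S with u ∈? Z
    ... | no u∉Z = inj₁ (x∈p∪q⁺ (inj₁ (x∈p∧x∉q⇒x∈p─q u∈S u∉Z)))
    ... | yes u∈Z with T-cover u v uv
    ...   | inj₁ u∈T = ⊥-elim (x∈p─q⇒x∉q S T (Z⊆S─T u∈Z) u∈T)
    ...   | inj₂ v∈T with v ∈? S
    ...     | yes v∈S = inj₂ (x∈p∪q⁺ (inj₁ (x∈p∧x∉q⇒x∈p─q v∈S (λ v∈Z → x∈p─q⇒x∉q S T (Z⊆S─T v∈Z) v∈T))))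
    ...     | no  v∉S = inj₂ (x∈p∪q⁺ (inj₂ (x∈p∩q⁺ (∈-N⁺ u∈Z uv , x∈p∧x∉q⇒x∈p─q v∈T v∉S))))


  Closed⇒IsVertexCover : ∀ {k} {W : Config G k → Set} → Closed G W → ∀ {c} → W c → IsVertexCover G (image c)
  Closed⇒IsVertexCover closed {c} Wc u v uv with closed c Wc u v uv
  ... | _ , (_ , _ , _ , inj₁ (ci≡u , _)) , _ = inj₁ (∈-image⁺ c ci≡u)
  ... | _ , (_ , _ , _ , inj₂ (ci≡v , _)) , _ = inj₂ (∈-image⁺ c ci≡v)

  mvc≤guards : ∀ {k j} → MvcIs G k → DefenderWins G j → k ≤ j
  mvc≤guards {j = j} (_ , (_ , S-min) , refl) (_ , closed , c , _ , Wc) =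
    ≤-trans (S-min (image c) (Closed⇒IsVertexCover closed Wc)) (∣image∣≤k j c)

  guards-minimal : ∀ {k} → MvcIs G k → ∀ (c : Config G k) U → IsVertexCover G U → ∣ image c ∣ ≤ ∣ U ∣
  guards-minimal (_ , (_ , S-min) , refl) c U U-cover = ≤-trans (∣image∣≤k _ c) (S-min U U-cover)

  Closed⇒IsMinVertexCover : ∀ {k} {W : Config G k → Set} → MvcIs G k → Closed G W → ∀ {c} → W c →
                            IsMinVertexCover G (image c)
  Closed⇒IsMinVertexCover mvc closed {c} Wc = Closed⇒IsVertexCover closed Wc , guards-minimal mvc c

  LeavesInMinCovers : Set
  LeavesInMinCovers = ∀ v → degree G v ≡ 1 → Σ (Subset n) (λ S → IsMinVertexCover G S × v ∈ S)

  DefenderWins⇒LeavesInMinCovers : ∀ {k} → MvcIs G k → DefenderWins G k → LeavesInMinCovers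
  DefenderWins⇒LeavesInMinCovers mvc (W , closed , c , _ , Wc) x deg≡1 with leaf-neighbour deg≡1
  ... | y , xy with closed c Wc y x (Edge-sym xy)
  ...   | c′ , (w , _ , i , inj₁ (ci≡y , first→x)) , Wc′ =
    image c′ , Closed⇒IsMinVertexCover mvc closed Wc′ ,
    ∈-image⁺ c′ (walk-into-leaf (w i) first→x (λ xz → trans (leaf-neighbour-unique deg≡1 xz xy) (sym ci≡y)))
  ...   | _ , (_ , _ , i , inj₂ (ci≡x , _)) , _ =
    image c , Closed⇒IsMinVertexCover mvc closed Wc , ∈-image⁺ c ci≡x

  Safe : ∀ {k} → Config G k → Set
  Safe c = Injective _≡_ _≡_ c × IsVertexCover G (image c)

  SafeResponse : ∀ {k} → Fin n → Fin n → Config G k → Set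
  SafeResponse {k} a b c = Σ (Config G k) λ c′ → Response G a b c c′ × Safe c′

  SafeResponse-sym : ∀ {k a b} {c : Config G k} → SafeResponse b a c → SafeResponse a b c
  SafeResponse-sym (c′ , (w , c′-inj , i , attacked) , safe′) = c′ , (w , c′-inj , i , Sum.swap attacked) , safe′

  swap-walk : ∀ {a w} → Walk G a w → Walk G w a → ∀ x → Walk G x (transpose a w x)
  swap-walk {a} {w} a⇝w w⇝a x with x ≟ a
  ... | yes refl = a⇝w
  ... | no _ with x ≟ w
  ...   | yes refl = w⇝a
  ...   | no _     = stay x

  swap-walk-first : ∀ {x a w b} (a⇝w : Walk G a w) (w⇝a : Walk G w a) → FirstStepTo G a⇝w b →
                    x ≡ a → FirstStepTo G (swap-walk a⇝w w⇝a x) b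
  swap-walk-first {x} {a} _ _ first x≡a with x ≟ a
  ... | yes refl = first
  ... | no  x≢a  = ⊥-elim (x≢a x≡a)

  swap-response : ∀ {k a w b} {c : Config G k} → Safe c → a ∈ image c → w ∈ image c →
                  (a⇝w : Walk G a w) → Walk G w a → FirstStepTo G a⇝w b → SafeResponse a b c
  swap-response {a = a} {w} {c = c} (c-inj , cover) a∈ w∈ a⇝w w⇝a first with ∈-image⁻ c a∈
  ... | i , ci≡a = c′ , ((λ j → swap-walk a⇝w w⇝a (c j)) , c′-inj , i , inj₁ (ci≡a , swap-walk-first a⇝w w⇝a first ci≡a)) , c′-inj , c′-cover
    where
    c′ : Config G _
    c′ = transpose a w ∘′ c
    c′-inj : Injective _≡_ _≡_ c′
    c′-inj {j} {l} c′j≡c′l = c-inj (begin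
      c j                                ≡⟨ sym (transpose-inverse w a) ⟩
      transpose w a (transpose a w (c j)) ≡⟨ cong (transpose w a) c′j≡c′l ⟩
      transpose w a (transpose a w (c l)) ≡⟨ transpose-inverse w a ⟩
      c l                                ∎)
      where open ≡-Reasoning
    image⊆ : image c ⊆ image c′
    image⊆ {x} x∈ with ∈-image⁻ c (transpose-preserves (_∈ image c) w∈ a∈ x∈)
    ... | j , cj≡ = ∈-image⁺ c′ (trans (cong (transpose a w) cj≡) (transpose-inverse a w))
    c′-cover : IsVertexCover G (image c′)
    c′-cover = cover-mono image⊆ cover

  module Shift {k} (c : Config G k) (T : Subset n) (M : Matching (image c ─ T) (T ─ image c)) where
    open Matching M

    move : Fin n → Fin n
    move x with x ∈? image c ─ T
    ... | yes _ = f x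
    ... | no  _ = x

    move-walk : ∀ x → Walk G x (move x)
    move-walk x with x ∈? image c ─ T
    ... | yes x∈ = step1 (matched x∈)
    ... | no  _  = stay x

    move-walk-first : x ∈ image c ─ T → FirstStepTo G (move-walk x) (f x)
    move-walk-first {x} x∈ with x ∈? image c ─ T
    ... | yes _  = refl
    ... | no  x∉ = ⊥-elim (x∉ x∈)

    move-injectiveOn : InjectiveOn move (image c)
    move-injectiveOn {x} {y} x∈S y∈S mx≡my with x ∈? image c ─ T | y ∈? image c ─ T
    ... | yes x∈ | yes y∈ = injectiveOn x∈ y∈ mx≡my
    ... | no  _  | no  _  = mx≡my
    ... | yes x∈ | no  _  = ⊥-elim (x∈p─q⇒x∉q T (image c) (mapsTo x∈) (subst (_∈ image c) (sym mx≡my) y∈S))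
    ... | no  _  | yes y∈ = ⊥-elim (x∈p─q⇒x∉q T (image c) (mapsTo y∈) (subst (_∈ image c) mx≡my x∈S))

    move-fixed : x ∉ image c ─ T → move x ≡ x
    move-fixed {x} x∉ with x ∈? image c ─ T
    ... | yes x∈ = ⊥-elim (x∉ x∈)
    ... | no  _  = refl

    move-matched : x ∈ image c ─ T → move x ≡ f x
    move-matched {x} x∈ with x ∈? image c ─ T
    ... | yes _  = refl
    ... | no  x∉ = ⊥-elim (x∉ x∈)

    T⊆image-move : (∀ {y} → y ∈ T ─ image c → ∃ λ x → x ∈ image c ─ T × f x ≡ y) → T ⊆ image (move ∘′ c)
    T⊆image-move onto {y} y∈T with y ∈? image c
    ... | yes y∈S with ∈-image⁻ c y∈S
    ...   | i , refl = ∈-image⁺ (move ∘′ c) (move-fixed (λ y∈S─T → x∈p─q⇒x∉q (image c) T y∈S─T y∈T))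
    T⊆image-move onto {y} y∈T | no y∉S with onto (x∈p∧x∉q⇒x∈p─q y∈T y∉S)
    ... | x , x∈ , fx≡y with ∈-image⁻ c (p─q⊆p (image c) T x∈)
    ...   | i , refl = ∈-image⁺ (move ∘′ c) (trans (move-matched x∈) fx≡y)

  shift-response : ∀ {k a b T} {c : Config G k} → Safe c → IsVertexCover G T →
                   (M : Matching (image c ─ T) (T ─ image c)) →
                   (∀ {y} → y ∈ T ─ image c → ∃ λ x → x ∈ image c ─ T × Matching.f M x ≡ y) →
                   a ∈ image c ─ T → Matching.f M a ≡ b → SafeResponse a b c
  shift-response {T = T} {c} (c-inj , _) T-cover M onto a∈ fa≡b with ∈-image⁻ c (p─q⊆p (image c) T a∈)
  ... | i , refl = move ∘′ c , ((λ j → move-walk (c j)) , c′-inj , i , inj₁ (refl , first)) , c′-inj , c′-cover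
    where
    open Shift c T M
    c′-inj : Injective _≡_ _≡_ (move ∘′ c)
    c′-inj mcj≡mcl = c-inj (move-injectiveOn (∈-image⁺ c refl) (∈-image⁺ c refl) mcj≡mcl)
    first : FirstStepTo G (move-walk (c i)) _
    first = subst (FirstStepTo G (move-walk (c i))) fa≡b (move-walk-first a∈)
    c′-cover : IsVertexCover G (image (move ∘′ c))
    c′-cover = cover-mono (T⊆image-move onto) T-cover

  leaf-response : ∀ {k a b} {c : Config G k} → MvcIs G k → Safe c → a ∈ image c → b ∉ image c →
                  (∀ {w} → Edge G b w → w ≡ a) → Σ (Subset n) (λ T → IsMinVertexCover G T × b ∈ T) →
                  SafeResponse a b c
  leaf-response {b = b} {c} mvc safe@(_ , cover) a∈ b∉ only-a (T , (T-cover , T-min) , b∈T) =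
    let x , x∈ , fx≡b = onto (x∈p∧x∉q⇒x∈p─q b∈T b∉)
        x≡a = only-a (Edge-sym (subst (Edge G x) fx≡b (Matching.matched M x∈)))
    in subst (λ a → SafeResponse a b c) x≡a (shift-response safe T-cover M onto x∈ fx≡b)
    where
    M : Matching (image c ─ T) (T ─ image c)
    M = hall (minCover-hallCondition cover (guards-minimal mvc c) T-cover)
    onto : ∀ {y} → y ∈ T ─ image c → ∃ λ x → x ∈ image c ─ T × Matching.f M x ≡ y
    onto = injectiveOn⇒surjectiveOn (Matching.f M) (Matching.mapsTo M) (Matching.injectiveOn M)
             (∣q─p∣≤∣p─q∣ (image c) T (T-min (image c) cover))

  module _ {k} (mvc : MvcIs G k) (leaves : LeavesInMinCovers) where

    respond-outside : ∀ {a b} {c : Config G k} → Safe c → a ∈ image c → b ∉ image c → Edge G a b → SafeResponse a b c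
    respond-outside {a} {b} safe@(_ , cover) a∈ b∉ ab with any? (λ w → ¬? (w ≟ a) ×-dec Edge? b w)
    ... | yes (w , w≢a , bw) =
      swap-response safe a∈ w∈ (step2 ab bw w≢a) (step2 (Edge-sym bw) (Edge-sym ab) (w≢a ∘′ sym)) refl
      where
      w∈ : w ∈ _
      w∈ = Sum.fromInj₂ (⊥-elim ∘′ b∉) (cover b w bw)
    ... | no no-other = leaf-response mvc safe a∈ b∉ only-a (leaves b (unique-neighbour⇒leaf (Edge-sym ab) only-a))
      where
      only-a : ∀ {w} → Edge G b w → w ≡ a
      only-a {w} bw with w ≟ a
      ... | yes w≡a = w≡a
      ... | no  w≢a = ⊥-elim (no-other (w , w≢a , bw))

    Safe-closed : Closed G (Safe {k})
    Safe-closed c safe@(_ , cover) a b ab with a ∈? image c | b ∈? image c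
    ... | yes a∈ | yes b∈ = swap-response safe a∈ b∈ (step1 ab) (step1 (Edge-sym ab)) refl
    ... | yes a∈ | no  b∉ = respond-outside safe a∈ b∉ ab
    ... | no  a∉ | yes b∈ = SafeResponse-sym (respond-outside safe b∈ a∉ (Edge-sym ab))
    ... | no  a∉ | no  b∉ = ⊥-elim (Sum.[ a∉ , b∉ ] (cover a b ab))

  LeavesInMinCovers⇒DefenderWins : ∀ {k} → MvcIs G k → LeavesInMinCovers → DefenderWins G k
  LeavesInMinCovers⇒DefenderWins mvc@(S , (S-cover , _) , refl) leaves with enumerate S
  ... | c , c-inj , S⊆ = Safe , Safe-closed mvc leaves , c , c-inj , c-inj , cover-mono S⊆ S-cover

lemma22 : ∀ {n} (G : Graph n) (k : ℕ) → MvcIs G k →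
    (NevcIs G k ⇔ (∀ (v : Fin n) → degree G v ≡ 1 →
                     Σ (Subset n) (λ S → IsMinVertexCover G S × v ∈ S)))
lemma22 G k mvc = mk⇔
  (λ (wins , _) → DefenderWins⇒LeavesInMinCovers G mvc wins)
  (λ leaves → LeavesInMinCovers⇒DefenderWins G mvc leaves , λ j j<k wins → <⇒≱ j<k (mvc≤guards G mvc wins))
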